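{- For every $n\ge 2$, $$\sum_{\sigma\in\widehat{\mathcal{Q}}_{n+1}}(-1)^{\mathrm{cyc}(\sigma)}=n-1.$$
   Context: For $\sigma\in\mathfrak{S}_m$, $\mathrm{cyc}(\sigma)$ is the number of cycles of $\sigma$. $\widehat{\mathcal{Q}}_m$ is the set of $\sigma\in\mathfrak{S}_m$ whose cycle containing $m$, written as $(c_1,\dots,c_k,m)$ ending with $m$ (i.e. $\sigma(c_i)=c_{i+1}$, $\sigma(c_k)=m$, $\sigma(m)=c_1$), satisfies $c_1<c_2<\cdots<c_k$ (possibly $k=0$). -}

module Defs where

open import Data.Bool using (Bool; true; false; _∧_; not)
open import Data.Nat using (ℕ; zero; suc; _≤ᵇ_; _<ᵇ_)
open import Data.Fin using (Fin; toℕ; fromℕ; _≟_)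
open import Data.List using (List; []; _∷_; map; concatMap; allFin; filterᵇ; length; foldr; upTo)
open import Data.Vec using (Vec; lookup; toList) renaming ([] to []ᵥ; _∷_ to _∷ᵥ_)
open import Data.Integer using (ℤ; -1ℤ; 0ℤ; _+_; _^_)
open import Relation.Nullary.Decidable using (⌊_⌋)

-- The point i ∈ {1,…,m} of the paper corresponds to the index i-1 : Fin m;
-- in particular the paper's element m is  fromℕ (m-1)  (the last element).

all : ∀ {A : Set} → (A → Bool) → List A → Bool
all p []       = true
all p (x ∷ xs) = p x ∧ all p xs

allTables : (k m : ℕ) → List (Vec (Fin k) m)
allTables k zero    = []ᵥ ∷ []
allTables k (suc m) = concatMap (λ x → map (x ∷ᵥ_) (allTables k m)) (allFin k)

_==_ : ∀ {m} → Fin m → Fin m → Bool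
i == j = ⌊ i ≟ j ⌋

-- a table is a permutation iff it is injective (finite set)
isInjective : ∀ {m} → Vec (Fin m) m → Bool
isInjective {m} v =
  all (λ i → all (λ j → not (lookup v i == lookup v j) Data.Bool.∨ (i == j)) (allFin m)) (allFin m)

Sym : (m : ℕ) → List (Vec (Fin m) m)
Sym m = filterᵇ isInjective (allTables m m)

iter : ∀ {m} → Vec (Fin m) m → ℕ → Fin m → Fin m
iter σ zero    x = x
iter σ (suc j) x = lookup σ (iter σ j x)

-- i is the minimum of its cycle: i ≤ σ^j(i) for all 1 ≤ j ≤ m (cycles have length ≤ m)
isCycleMin : ∀ {m} → Vec (Fin m) m → Fin m → Bool
isCycleMin {m} σ i = all (λ j → toℕ i ≤ᵇ toℕ (iter σ (suc j) i)) (upTo m)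

-- cyc(σ): the number of cycles of σ = the number of cycle minima
cyc : ∀ {m} → Vec (Fin m) m → ℕ
cyc {m} σ = length (filterᵇ (isCycleMin σ) (allFin m))

-- the list c₁, c₂, …, c_k of the cycle (c₁,…,c_k,m): start at σ(m), follow σ
-- until m is reached (fuel m suffices since the cycle has length ≤ m)
cycleWalk : ∀ {m} → Vec (Fin m) m → Fin m → ℕ → Fin m → List (Fin m)
cycleWalk σ top zero    x = []
cycleWalk σ top (suc f) x with x == top
... | true  = []
... | false = x ∷ cycleWalk σ top f (lookup σ x)

strictlyIncreasing : ∀ {m} → List (Fin m) → Bool
strictlyIncreasing []           = true
strictlyIncreasing (x ∷ [])     = true
strictlyIncreasing (x ∷ y ∷ xs) = (toℕ x <ᵇ toℕ y) ∧ strictlyIncreasing (y ∷ xs)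

-- membership in Q̂_{m}, for m = suc n (the largest element m is fromℕ n)
inQhat : ∀ {n} → Vec (Fin (suc n)) (suc n) → Bool
inQhat {n} σ = strictlyIncreasing (cycleWalk σ (fromℕ n) (suc n) (lookup σ (fromℕ n)))

Qhat : (n : ℕ) → List (Vec (Fin (suc n)) (suc n))
Qhat n = filterᵇ inQhat (Sym (suc n))

sumℤ : List ℤ → ℤ
sumℤ = foldr _+_ 0ℤ

{-# OPTIONS --safe #-}
-- Pair σ ∈ Q̂_{n+1} with σ ∘ (a b), where a < b are the two least points outside the cycle of
-- n+1 (when there are two). The transposition splits the cycle through a and b, or merges the
-- cycles through them, so the number of cycles changes by one; it does not touch the cycle of
-- n+1, so σ ∘ (a b) lies in Q̂_{n+1} and has the same two least points outside that cycle.
-- This sign-reversing involution reduces the sum to its fixed points: the permutations made of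
-- the increasing cycle of n+1 and at most one fixed point. The full cycle has sign −1 and the
-- n cycles missing a single point k ≤ n have sign +1, which gives n − 1.
module Submission where

open import Algebra.Definitions using (Involutive)
open import Data.Bool using (Bool; true; false; T; _∨_; not)
open import Data.Bool.Properties using (T-∧)
open import Data.Empty using (⊥-elim)
open import Data.Fin using (Fin; toℕ; fromℕ; inject₁; lower₁; _≟_)
import Data.Fin as Fin
import Data.Fin.Properties as Fin
open import Data.Fin.Permutation.Components using (transpose)
open import Data.Integer using (ℤ; 0ℤ; -1ℤ; +_; -[1+_]; -_; _+_; _-_; _^_)
import Data.Integer.Properties as ℤ
open import Algebra.Properties.CommutativeSemigroup ℤ.+-commutativeSemigroup using (x∙yz≈y∙xz)
open import Data.List using (List; []; _∷_; map; filter; filterᵇ; length; allFin; upTo; concatMap; cartesianProductWith)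
import Data.List as List
open import Data.List.Membership.Propositional using (_∈_; _∉_)
open import Data.List.Membership.Propositional.Properties
  using (∈-filter⁺; ∈-filter⁻; ∈-map⁺; ∈-map⁻; ∈-allFin; ∈-upTo⁺; ∈-cartesianProductWith⁺)
open import Data.List.Membership.Propositional.Properties.WithK using (unique∧set⇒bag)
import Data.List.Membership.DecPropositional as DecMembership
open import Data.List.Properties using (map-∘; map-cong-local; map-tabulate; length-map; length-filter)
import Data.List.Properties as List
open import Data.List.Relation.Binary.BagAndSetEquality using (∼bag⇒↭)
open import Data.List.Relation.Binary.Equality.Propositional using (≋⇒≡)
open import Data.List.Relation.Binary.Permutation.Propositional using (_↭_; ↭⇒↭ₛ)
import Data.List.Relation.Binary.Permutation.Propositional.Properties as ↭
open import Data.List.Relation.Binary.Permutation.Setoid.Properties using (foldr-commMonoid)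
open import Data.List.Relation.Binary.Subset.Propositional using (_⊆_)
open import Data.List.Relation.Unary.All using (All; []; _∷_)
import Data.List.Relation.Unary.All as All
open import Data.List.Relation.Unary.AllPairs using (AllPairs; []; _∷_)
import Data.List.Relation.Unary.AllPairs as AllPairs
import Data.List.Relation.Unary.AllPairs.Properties as AllPairs
open import Data.List.Relation.Unary.Any using (here; there)
open import Data.List.Relation.Unary.Linked using (Linked; []; [-]; _∷_)
import Data.List.Relation.Unary.Linked.Properties as Linked
open import Data.List.Relation.Unary.Sorted.TotalOrder.Properties using (↗↭↗⇒≋)
open import Data.List.Relation.Unary.Unique.Propositional using (Unique)
import Data.List.Relation.Unary.Unique.Propositional.Properties as Unique
open import Data.Nat using (ℕ; zero; suc; _≤_; _<_; s≤s; _∸_)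
import Data.Nat as ℕ
open import Data.Nat.DivMod using (_%_; _/_; m≡m%n+[m/n]*n; m%n<n)
open import Data.Nat.Properties hiding (_≟_)
open import Data.Product using (∃-syntax; _×_; _,_; proj₁; proj₂)
open import Data.Sum using (_⊎_; inj₁; inj₂)
open import Data.Vec using (Vec; lookup; tabulate) renaming ([] to []ᵥ; _∷_ to _∷ᵥ_)
import Data.Vec.Properties as Vec
open import Data.Vec.Properties using (lookup∘tabulate; tabulate∘lookup; tabulate-cong)
open import Function using (_∘_; id; case_of_; _⇔_; mk⇔; Equivalence)
open Equivalence using (to; from)
open import Function.Definitions using (Injective)
open import Level using (0ℓ)
open import Relation.Binary.Definitions using (DecidableEquality)
open import Relation.Binary.PropositionalEquality
open import Relation.Nullary using (¬_; Dec; yes; no; does; ¬?)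
open import Relation.Nullary.Decidable using (T?; toWitness; fromWitness; dec-true; dec-false)
open import Relation.Unary using (Pred; Decidable)

open import Defs

private variable
  A : Set
  m : ℕ

unique-⊆-⊇⇒↭ : {xs ys : List A} → Unique xs → Unique ys → xs ⊆ ys → ys ⊆ xs → xs ↭ ys
unique-⊆-⊇⇒↭ xs! ys! xs⊆ys ys⊆xs = ∼bag⇒↭ (unique∧set⇒bag xs! ys! (mk⇔ xs⊆ys ys⊆xs))

length-≤-⊆ : DecidableEquality A → {xs ys : List A} → Unique xs → Unique ys → xs ⊆ ys → length xs ≤ length ys
length-≤-⊆ _≟_ {xs} {ys} xs! ys! xs⊆ys = ≤-trans
  (≤-reflexive (↭.↭-length (unique-⊆-⊇⇒↭ xs! (Unique.filter⁺ (_∈? xs) ys!)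
    (λ x∈ → ∈-filter⁺ (_∈? xs) (xs⊆ys x∈) x∈) (proj₂ ∘ ∈-filter⁻ (_∈? xs) {xs = ys}))))
  (length-filter (_∈? xs) ys)
  where open DecMembership _≟_

sumℤ-↭ : {xs ys : List ℤ} → xs ↭ ys → sumℤ xs ≡ sumℤ ys
sumℤ-↭ p = foldr-commMonoid (setoid ℤ) ℤ.+-0-isCommutativeMonoid (↭⇒↭ₛ p)

sumℤ-map-filter : (f : A → ℤ) {P : Pred A 0ℓ} (P? : Decidable P) (xs : List A) →
  sumℤ (map f xs) ≡ sumℤ (map f (filter P? xs)) + sumℤ (map f (filter (¬? ∘ P?) xs))
sumℤ-map-filter f P? [] = refl
sumℤ-map-filter f P? (x ∷ xs) with does (P? x)
... | true  = trans (cong (_+_ (f x)) (sumℤ-map-filter f P? xs)) (sym (ℤ.+-assoc (f x) _ _))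
... | false = trans (cong (_+_ (f x)) (sumℤ-map-filter f P? xs))
  (x∙yz≈y∙xz (f x) (sumℤ (map f (filter P? xs))) (sumℤ (map f (filter (¬? ∘ P?) xs))))

i≡-i⇒i≡0 : ∀ i → i ≡ - i → i ≡ 0ℤ
i≡-i⇒i≡0 (+ zero)  _  = refl
i≡-i⇒i≡0 (+ (suc _)) ()
i≡-i⇒i≡0 -[1+ _ ] ()

sumℤ-map-neg : (f : A → ℤ) (xs : List A) → sumℤ (map (-_ ∘ f) xs) ≡ - sumℤ (map f xs)
sumℤ-map-neg f [] = refl
sumℤ-map-neg f (x ∷ xs) = trans (cong (_+_ (- f x)) (sumℤ-map-neg f xs)) (sym (ℤ.neg-distrib-+ (f x) _))

module _ (_≟_ : DecidableEquality A) (f : A → ℤ) (ι : A → A) (ι-involutive : Involutive _≡_ ι) where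

  sumℤ-over-fixedPoints : ∀ {xs} → Unique xs → (∀ {x} → x ∈ xs → ι x ∈ xs) →
    (∀ {x} → x ∈ xs → ι x ≢ x → f (ι x) ≡ - f x) →
    sumℤ (map f xs) ≡ sumℤ (map f (filter (λ x → ι x ≟ x) xs))
  sumℤ-over-fixedPoints {xs} xs! ι-closed ι-reverses = begin
    sumℤ (map f xs)                   ≡⟨ sumℤ-map-filter f fixed? xs ⟩
    sumℤ (map f fixed) + sumℤ (map f moved) ≡⟨ cong (_+_ (sumℤ (map f fixed))) moved-sum≡0 ⟩
    sumℤ (map f fixed) + 0ℤ          ≡⟨ ℤ.+-identityʳ _ ⟩
    sumℤ (map f fixed)               ∎
    where
    open ≡-Reasoning
    fixed? = λ x → ι x ≟ x
    fixed = filter fixed? xs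
    moved = filter (¬? ∘ fixed?) xs
    ι-injective : ∀ {x y} → ι x ≡ ι y → x ≡ y
    ι-injective {x} {y} e = trans (sym (ι-involutive x)) (trans (cong ι e) (ι-involutive y))
    ι-moved : ∀ {x} → x ∈ moved → ι x ∈ moved
    ι-moved x∈ with ∈-filter⁻ (¬? ∘ fixed?) x∈
    ... | x∈xs , ιx≢x = ∈-filter⁺ (¬? ∘ fixed?) (ι-closed x∈xs) (λ e → ιx≢x (ι-injective e))
    moved! : Unique moved
    moved! = Unique.filter⁺ (¬? ∘ fixed?) xs!
    map-ι-moved : map ι moved ↭ moved
    map-ι-moved = unique-⊆-⊇⇒↭ (Unique.map⁺ ι-injective moved!) moved!
      (λ y∈ → case ∈-map⁻ ι y∈ of λ { (x , x∈ , refl) → ι-moved x∈ })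
      (λ {y} y∈ → subst (_∈ map ι moved) (ι-involutive y) (∈-map⁺ ι (ι-moved y∈)))
    ι-negates : ∀ {x} → x ∈ moved → f (ι x) ≡ - f x
    ι-negates x∈ with ∈-filter⁻ (¬? ∘ fixed?) x∈
    ... | x∈xs , ιx≢x = ι-reverses x∈xs ιx≢x
    moved-sum≡0 : sumℤ (map f moved) ≡ 0ℤ
    moved-sum≡0 = i≡-i⇒i≡0 _ (begin
      sumℤ (map f moved)          ≡⟨ sumℤ-↭ (↭.map⁺ f map-ι-moved) ⟨
      sumℤ (map f (map ι moved))  ≡⟨ cong sumℤ (map-∘ moved) ⟨
      sumℤ (map (f ∘ ι) moved)    ≡⟨ cong sumℤ (map-cong-local (All.tabulate ι-negates)) ⟩
      sumℤ (map (-_ ∘ f) moved)   ≡⟨ sumℤ-map-neg f moved ⟩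
      - sumℤ (map f moved)        ∎)

sumℤ-ones : ∀ n → sumℤ (List.tabulate {n = n} (λ _ → + 1)) ≡ + n
sumℤ-ones zero    = refl
sumℤ-ones (suc n) = cong (_+_ (+ 1)) (sumℤ-ones n)

-1^suc : ∀ k → -1ℤ ^ suc k ≡ - (-1ℤ ^ k)
-1^suc k = ℤ.-1*i≡-i (-1ℤ ^ k)

module _ (p q : A → Bool) where

  length-filterᵇ-cong : ∀ {xs} → (∀ {x} → x ∈ xs → p x ≡ q x) → length (filterᵇ p xs) ≡ length (filterᵇ q xs)
  length-filterᵇ-cong {[]}     _     = refl
  length-filterᵇ-cong {x ∷ xs} p≗q with p x | q x | p≗q (here refl) | length-filterᵇ-cong (p≗q ∘ there)
  ... | true  | true  | _ | eq = cong suc eq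
  ... | false | false | _ | eq = eq

  -1^length-filterᵇ-flip : ∀ {c xs} → Unique xs → c ∈ xs → (∀ {x} → x ≢ c → p x ≡ q x) → p c ≡ not (q c) →
    -1ℤ ^ length (filterᵇ p xs) ≡ - (-1ℤ ^ length (filterᵇ q xs))
  -1^length-filterᵇ-flip {xs = x ∷ xs} (x≢xs ∷ _) (here refl) p≗q pc≡¬qc
    with p x | q x | pc≡¬qc | length-filterᵇ-cong {xs} (λ y∈xs → p≗q (λ { refl → All.lookup x≢xs y∈xs refl }))
  ... | true  | false | _ | eq rewrite eq = -1^suc (length (filterᵇ q xs))
  ... | false | true  | _ | eq rewrite eq =
    sym (trans (cong -_ (-1^suc (length (filterᵇ q xs)))) (ℤ.neg-involutive _))
  -1^length-filterᵇ-flip {xs = x ∷ xs} (x≢xs ∷ xs!) (there c∈xs) p≗q pc≡¬qc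
    with p x | q x | p≗q {x} (All.lookup x≢xs c∈xs) | -1^length-filterᵇ-flip xs! c∈xs p≗q pc≡¬qc
  ... | true  | true  | _ | ih =
    trans (-1^suc (length (filterᵇ p xs))) (trans (cong -_ ih) (cong -_ (sym (-1^suc (length (filterᵇ q xs))))))
  ... | false | false | _ | ih = ih

ascending⇒unique : {xs : List (Fin m)} → AllPairs Fin._<_ xs → Unique xs
ascending⇒unique = AllPairs.map Fin.<⇒≢

ascending-≡ : {xs ys : List (Fin m)} → AllPairs Fin._<_ xs → AllPairs Fin._<_ ys → xs ⊆ ys → ys ⊆ xs → xs ≡ ys
ascending-≡ {m} xs< ys< xs⊆ys ys⊆xs = ≋⇒≡ (↗↭↗⇒≋ (Fin.≤-totalOrder m) (sorted xs<) (sorted ys<)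
  (↭⇒↭ₛ (unique-⊆-⊇⇒↭ (ascending⇒unique xs<) (ascending⇒unique ys<) xs⊆ys ys⊆xs)))
  where
  sorted : ∀ {zs : List (Fin m)} → AllPairs Fin._<_ zs → Linked Fin._≤_ zs
  sorted = Linked.AllPairs⇒Linked ∘ AllPairs.map <⇒≤

module _ {a b : Fin m} {r : List (Fin m)} where

  ascending-first< : AllPairs Fin._<_ (a ∷ b ∷ r) → a Fin.< b
  ascending-first< ((a<b ∷ _) ∷ _) = a<b

  ascending-second-least : AllPairs Fin._<_ (a ∷ b ∷ r) → ∀ {y} → y ∈ a ∷ b ∷ r → y ≢ a → b Fin.≤ y
  ascending-second-least _                 (here refl)         y≢a = ⊥-elim (y≢a refl)
  ascending-second-least _                 (there (here refl)) _   = ≤-refl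
  ascending-second-least (_ ∷ (b<r ∷ _))   (there (there y∈r)) _   = <⇒≤ (All.lookup b<r y∈r)

T-not∨ : ∀ {u v} → T (not u ∨ v) ⇔ (T u → T v)
T-not∨ {true}  = mk⇔ (λ t _ → t) (λ f → f _)
T-not∨ {false} = mk⇔ (λ _ ()) (λ _ → _)

T-xor⇒≡not : ∀ {u v} → (T u × ¬ T v) ⊎ (¬ T u × T v) → u ≡ not v
T-xor⇒≡not {true}  {false} _                = refl
T-xor⇒≡not {false} {true}  _                = refl
T-xor⇒≡not {true}  {true}  (inj₁ (_ , ¬tv)) = ⊥-elim (¬tv _)
T-xor⇒≡not {true}  {true}  (inj₂ (¬tu , _)) = ⊥-elim (¬tu _)
T-xor⇒≡not {false} {false} (inj₁ (tu , _))  = ⊥-elim tu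
T-xor⇒≡not {false} {false} (inj₂ (_ , tv))  = ⊥-elim tv

T-injective : ∀ {u v} → (T u → T v) → (T v → T u) → u ≡ v
T-injective {true}  {true}  _ _ = refl
T-injective {true}  {false} f _ = ⊥-elim (f _)
T-injective {false} {true}  _ g = ⊥-elim (g _)
T-injective {false} {false} _ _ = refl

T-all : (p : A → Bool) (xs : List A) → T (all p xs) ⇔ All (T ∘ p) xs
T-all p [] = mk⇔ (λ _ → []) (λ _ → _)
T-all p (x ∷ xs) = mk⇔
  (λ t → let (tx , txs) = to T-∧ t in tx ∷ to (T-all p xs) txs)
  (λ { (tx ∷ txs) → from T-∧ (tx , from (T-all p xs) txs) })

T-== : {i j : Fin m} → T (i == j) ⇔ (i ≡ j)
T-== = mk⇔ toWitness fromWitness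

InjectiveTable : Vec (Fin m) m → Set
InjectiveTable σ = Injective _≡_ _≡_ (lookup σ)

T-isInjective : (σ : Vec (Fin m) m) → T (isInjective σ) ⇔ InjectiveTable σ
T-isInjective {m} σ = mk⇔
  (λ t {i} {j} σi≡σj → to T-== (to T-not∨ (entry t i j) (from T-== σi≡σj)))
  (λ inj → from (T-all _ (allFin m)) (All.universal (λ i →
     from (T-all _ (allFin m)) (All.universal (λ j →
       from T-not∨ (from T-== ∘ inj ∘ to T-==)) _)) _))
  where
  entry : T (isInjective σ) → ∀ i j → T (not (lookup σ i == lookup σ j) ∨ (i == j))
  entry t i j =
    All.lookup (to (T-all _ (allFin m)) (All.lookup (to (T-all _ (allFin m)) t) (∈-allFin i))) (∈-allFin j)

strictlyIncreasing⇒Linked : (xs : List (Fin m)) → T (strictlyIncreasing xs) → Linked Fin._<_ xs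
strictlyIncreasing⇒Linked []           _ = []
strictlyIncreasing⇒Linked (x ∷ [])     _ = [-]
strictlyIncreasing⇒Linked (x ∷ y ∷ xs) t =
  <ᵇ⇒< _ _ (proj₁ (to T-∧ t)) ∷ strictlyIncreasing⇒Linked (y ∷ xs) (proj₂ (to T-∧ t))

Linked⇒strictlyIncreasing : {xs : List (Fin m)} → Linked Fin._<_ xs → T (strictlyIncreasing xs)
Linked⇒strictlyIncreasing []           = _
Linked⇒strictlyIncreasing [-]          = _
Linked⇒strictlyIncreasing (x<y ∷ rest) = from T-∧ (<⇒<ᵇ x<y , Linked⇒strictlyIncreasing rest)

concatMap-map≡cartesianProductWith : ∀ {B C : Set} (f : A → B → C) xs ys →
  concatMap (λ x → map (f x) ys) xs ≡ cartesianProductWith f xs ys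
concatMap-map≡cartesianProductWith f [] ys = refl
concatMap-map≡cartesianProductWith f (x ∷ xs) ys =
  cong (map (f x) ys List.++_) (concatMap-map≡cartesianProductWith f xs ys)

module _ (k : ℕ) where

  ∈-allTables : ∀ {m} (v : Vec (Fin k) m) → v ∈ allTables k m
  ∈-allTables []ᵥ = here refl
  ∈-allTables {suc m} (x ∷ᵥ v) =
    subst (_ ∈_) (sym (concatMap-map≡cartesianProductWith _∷ᵥ_ (allFin k) (allTables k m)))
      (∈-cartesianProductWith⁺ _∷ᵥ_ (∈-allFin x) (∈-allTables v))

  allTables! : ∀ m → Unique (allTables k m)
  allTables! zero = [] ∷ []
  allTables! (suc m) =
    subst Unique (sym (concatMap-map≡cartesianProductWith _∷ᵥ_ (allFin k) (allTables k m)))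
      (Unique.cartesianProductWith⁺ _∷ᵥ_ Vec.∷-injective (Unique.allFin⁺ k) (allTables! m))

∈-Sym : {σ : Vec (Fin m) m} → σ ∈ Sym m ⇔ InjectiveTable σ
∈-Sym {m} {σ} = mk⇔
  (to (T-isInjective σ) ∘ proj₂ ∘ ∈-filter⁻ (T? ∘ isInjective) {xs = allTables m m})
  (∈-filter⁺ (T? ∘ isInjective) (∈-allTables m σ) ∘ from (T-isInjective σ))

Sym! : ∀ m → Unique (Sym m)
Sym! m = Unique.filter⁺ (T? ∘ isInjective) (allTables! m m)

∈-Qhat : ∀ {n} {σ : Vec (Fin (suc n)) (suc n)} → σ ∈ Qhat n ⇔ (InjectiveTable σ × T (inQhat σ))
∈-Qhat = mk⇔
  (λ σ∈ → let (σ∈Sym , q) = ∈-filter⁻ (T? ∘ inQhat) σ∈ in (λ {i} {j} → to ∈-Sym σ∈Sym {i} {j}) , q)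
  (λ p → ∈-filter⁺ (T? ∘ inQhat) (from ∈-Sym (λ {i} {j} → proj₁ p {i} {j})) (proj₂ p))

Qhat! : ∀ n → Unique (Qhat n)
Qhat! n = Unique.filter⁺ (T? ∘ inQhat) (Sym! (suc n))

-- Orbits of a permutation

least-witness : {P : ℕ → Set} → (∀ n → Dec (P n)) → ∀ {n} → P n →
  ∃[ k ] P k × (∀ {i} → i < k → ¬ P i)
least-witness {P} P? {n} Pn with search n
  where
  search : ∀ n → (∀ {i} → i < n → ¬ P i) ⊎ ∃[ k ] P k × (∀ {i} → i < k → ¬ P i)
  search zero = inj₁ λ ()
  search (suc n) with search n | P? n
  ... | inj₂ least     | _      = inj₂ least
  ... | inj₁ none      | yes Pn = inj₂ (n , Pn , none)
  ... | inj₁ none      | no ¬Pn = inj₁ λ i<n+1 → below (m≤n⇒m<n∨m≡n (≤-pred i<n+1))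
    where
    below : ∀ {i} → i < n ⊎ i ≡ n → ¬ P i
    below (inj₁ i<n)  = none i<n
    below (inj₂ refl) = ¬Pn
... | inj₁ none  = n , Pn , none
... | inj₂ least = least

_↝⟨_⟩_ : ∀ {m} → Fin m → Vec (Fin m) m → Fin m → Set
x ↝⟨ σ ⟩ y = ∃[ j ] iter σ j x ≡ y

module _ {m : ℕ} (σ : Vec (Fin m) m) where

  iter-suc : ∀ j x → iter σ (suc j) x ≡ iter σ j (lookup σ x)
  iter-suc zero    x = refl
  iter-suc (suc j) x = cong (lookup σ) (iter-suc j x)

  ↝-step : ∀ {x y} → lookup σ x ↝⟨ σ ⟩ y → x ↝⟨ σ ⟩ y
  ↝-step {x} (j , σʲσx≡y) = suc j , trans (iter-suc j x) σʲσx≡y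

  iter-+ : ∀ i j x → iter σ (i ℕ.+ j) x ≡ iter σ i (iter σ j x)
  iter-+ zero    j x = refl
  iter-+ (suc i) j x = cong (lookup σ) (iter-+ i j x)

  iter-* : ∀ {p x} → iter σ p x ≡ x → ∀ q → iter σ (q ℕ.* p) x ≡ x
  iter-* eq zero = refl
  iter-* {p} {x} eq (suc q) = begin
    iter σ (p ℕ.+ q ℕ.* p) x      ≡⟨ iter-+ p (q ℕ.* p) x ⟩
    iter σ p (iter σ (q ℕ.* p) x) ≡⟨ cong (iter σ p) (iter-* eq q) ⟩
    iter σ p x                    ≡⟨ eq ⟩
    x                             ∎
    where open ≡-Reasoning

  iter-% : ∀ {p x} → iter σ (suc p) x ≡ x → ∀ t → iter σ t x ≡ iter σ (t % suc p) x
  iter-% {p} {x} eq t = begin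
    iter σ t x                                            ≡⟨ cong (λ s → iter σ s x) (m≡m%n+[m/n]*n t (suc p)) ⟩
    iter σ (t % suc p ℕ.+ (t / suc p) ℕ.* suc p) x        ≡⟨ iter-+ (t % suc p) _ x ⟩
    iter σ (t % suc p) (iter σ ((t / suc p) ℕ.* suc p) x) ≡⟨ cong (iter σ (t % suc p)) (iter-* eq (t / suc p)) ⟩
    iter σ (t % suc p) x                                  ∎
    where open ≡-Reasoning

  cycleMin-intro : ∀ {x} → (∀ j → toℕ x ≤ toℕ (iter σ j x)) → T (isCycleMin σ x)
  cycleMin-intro x≤ = from (T-all _ (upTo m)) (All.universal (λ j → ≤⇒≤ᵇ (x≤ (suc j))) _)

  avoided-within-period : ∀ {d y z} → iter σ (suc d) y ≡ y → (∀ {i} → i ≤ d → iter σ i y ≢ z) →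
    ¬ y ↝⟨ σ ⟩ z
  avoided-within-period {d} σᵈ⁺¹y≡y avoids (j , σʲy≡z) =
    avoids (≤-pred (m%n<n j (suc d))) (trans (sym (iter-% σᵈ⁺¹y≡y j)) σʲy≡z)

  module _ (σ-injective : InjectiveTable σ) where

    iter-injective : ∀ j {x y} → iter σ j x ≡ iter σ j y → x ≡ y
    iter-injective zero    eq = eq
    iter-injective (suc j) eq = iter-injective j (σ-injective eq)

    -- the pigeonhole principle applied to x, σ x, …, σ^m x
    period : ∀ x → ∃[ p ] suc p ≤ m × iter σ (suc p) x ≡ x
    period x with Fin.pigeonhole (n<1+n m) (λ k → iter σ (toℕ k) x)
    ... | i , j , i<j , σⁱx≡σʲx = p , p<m , iter-injective (toℕ i) σⁱσᵖ⁺¹x≡σⁱx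
      where
      p = toℕ j ∸ suc (toℕ i)
      i+p+1≡j : toℕ i ℕ.+ suc p ≡ toℕ j
      i+p+1≡j = trans (+-suc (toℕ i) p) (m+[n∸m]≡n i<j)
      p<m : suc p ≤ m
      p<m = ≤-trans (subst (suc p ≤_) i+p+1≡j (m≤n+m (suc p) (toℕ i))) (≤-pred (Fin.toℕ<n j))
      σⁱσᵖ⁺¹x≡σⁱx : iter σ (toℕ i) (iter σ (suc p) x) ≡ iter σ (toℕ i) x
      σⁱσᵖ⁺¹x≡σⁱx = begin
        iter σ (toℕ i) (iter σ (suc p) x) ≡⟨ iter-+ (toℕ i) (suc p) x ⟨
        iter σ (toℕ i ℕ.+ suc p) x        ≡⟨ cong (λ s → iter σ s x) i+p+1≡j ⟩
        iter σ (toℕ j) x                  ≡⟨ σⁱx≡σʲx ⟨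
        iter σ (toℕ i) x                  ∎
        where open ≡-Reasoning

    ↝-sym : ∀ {x y} → x ↝⟨ σ ⟩ y → y ↝⟨ σ ⟩ x
    ↝-sym {x} {y} (s , σˢx≡y) with period x
    ... | q , _ , σ^q+1x≡x = q ℕ.* s , (begin
      iter σ (q ℕ.* s) y            ≡⟨ cong (iter σ (q ℕ.* s)) σˢx≡y ⟨
      iter σ (q ℕ.* s) (iter σ s x) ≡⟨ iter-+ (q ℕ.* s) s x ⟨
      iter σ (q ℕ.* s ℕ.+ s) x      ≡⟨ cong (λ t → iter σ t x) (trans (+-comm (q ℕ.* s) s) (*-comm (suc q) s)) ⟩
      iter σ (s ℕ.* suc q) x        ≡⟨ iter-* σ^q+1x≡x s ⟩
      x                             ∎)
      where open ≡-Reasoning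

    cycleMin-elim : ∀ {x} → T (isCycleMin σ x) → ∀ j → toℕ x ≤ toℕ (iter σ j x)
    cycleMin-elim {x} t j with period x
    ... | p , p<m , σᵖ⁺¹x≡x =
      subst (λ y → toℕ x ≤ toℕ y) (sym (iter-% σᵖ⁺¹x≡x j)) (within (j % suc p) (m%n<n j (suc p)))
      where
      within : ∀ r → r < suc p → toℕ x ≤ toℕ (iter σ r x)
      within zero    _     = ≤-refl
      within (suc r) r<p+1 = ≤ᵇ⇒≤ _ _ (All.lookup (to (T-all _ (upTo m)) t)
        (∈-upTo⁺ (<-≤-trans (≤-trans (n≤1+n (suc r)) r<p+1) p<m)))

    smaller-in-cycle⇒¬cycleMin : ∀ {x y} → x ↝⟨ σ ⟩ y → toℕ y < toℕ x → ¬ T (isCycleMin σ x)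
    smaller-in-cycle⇒¬cycleMin (j , refl) y<x t = <⇒≱ y<x (cycleMin-elim t j)

-- Transposing the two least points of a union of cycles

transpose-a : ∀ (a b : Fin m) → transpose a b a ≡ b
transpose-a a b rewrite dec-true (a ≟ a) refl = refl

transpose-b : ∀ (a b : Fin m) → transpose a b b ≡ a
transpose-b a b with b ≟ a
... | yes b≡a = b≡a
... | no  _   rewrite dec-true (b ≟ b) refl = refl

module _ {a b : Fin m} where

  transpose-other : ∀ {x} → x ≢ a → x ≢ b → transpose a b x ≡ x
  transpose-other {x} x≢a x≢b rewrite dec-false (x ≟ a) x≢a | dec-false (x ≟ b) x≢b = refl

  transpose-involutive : ∀ x → transpose a b (transpose a b x) ≡ x
  transpose-involutive x = by-cases (x ≟ a) (x ≟ b)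
    where
    by-cases : Dec (x ≡ a) → Dec (x ≡ b) → transpose a b (transpose a b x) ≡ x
    by-cases (yes refl) _          = trans (cong (transpose a b) (transpose-a a b)) (transpose-b a b)
    by-cases (no _)     (yes refl) = trans (cong (transpose a b) (transpose-b a b)) (transpose-a a b)
    by-cases (no x≢a)   (no x≢b)   =
      trans (cong (transpose a b) (transpose-other x≢a x≢b)) (transpose-other x≢a x≢b)

_∘⟨_⇄_⟩ : Vec (Fin m) m → Fin m → Fin m → Vec (Fin m) m
σ ∘⟨ a ⇄ b ⟩ = tabulate (lookup σ ∘ transpose a b)

module _ (σ : Vec (Fin m) m) (a b : Fin m) where

  lookup-∘⇄ : ∀ x → lookup (σ ∘⟨ a ⇄ b ⟩) x ≡ lookup σ (transpose a b x)
  lookup-∘⇄ = lookup∘tabulate (lookup σ ∘ transpose a b)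

  ∘⇄-involutive : σ ∘⟨ a ⇄ b ⟩ ∘⟨ a ⇄ b ⟩ ≡ σ
  ∘⇄-involutive = trans
    (tabulate-cong (λ x → trans (lookup-∘⇄ (transpose a b x)) (cong (lookup σ) (transpose-involutive x))))
    (tabulate∘lookup σ)

  ∘⇄-injective : InjectiveTable σ → InjectiveTable (σ ∘⟨ a ⇄ b ⟩)
  ∘⇄-injective σ-injective {x} {y} eq = begin
    x                               ≡⟨ transpose-involutive x ⟨
    transpose a b (transpose a b x) ≡⟨ cong (transpose a b) (σ-injective (trans (sym (lookup-∘⇄ x))
                                                                              (trans eq (lookup-∘⇄ y)))) ⟩
    transpose a b (transpose a b y) ≡⟨ transpose-involutive y ⟩
    y                               ∎
    where open ≡-Reasoning

record UnionOfCycles (R : Pred (Fin m) 0ℓ) (τ : Vec (Fin m) m) : Set where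
  field
    injective : InjectiveTable τ
    preserves : ∀ {x} → R x → R (lookup τ x)
    reflects  : ∀ {x} → R (lookup τ x) → R x

  iter-preserves : ∀ j {x} → R x → R (iter τ j x)
  iter-preserves zero    Rx = Rx
  iter-preserves (suc j) Rx = preserves (iter-preserves j Rx)

  iter-reflects : ∀ j {x} → R (iter τ j x) → R x
  iter-reflects zero    Rx = Rx
  iter-reflects (suc j) Rx = iter-reflects j (reflects Rx)

module SwapLeastPair {R : Pred (Fin m) 0ℓ} {a b : Fin m}
  (Ra : R a) (Rb : R b) (a<b : toℕ a < toℕ b) (b-least : ∀ {y} → R y → y ≢ a → toℕ b ≤ toℕ y) where

  a≢b : a ≢ b
  a≢b a≡b = <-irrefl (cong toℕ a≡b) a<b

  a-least : ∀ {y} → R y → toℕ a ≤ toℕ y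
  a-least {y} Ry with y ≟ a
  ... | yes refl = ≤-refl
  ... | no  y≢a  = ≤-trans (<⇒≤ a<b) (b-least Ry y≢a)

  Hit : Fin m → Set
  Hit y = y ≡ a ⊎ y ≡ b

  hit? : ∀ y → Dec (Hit y)
  hit? y with y ≟ a | y ≟ b
  ... | yes y≡a | _       = yes (inj₁ y≡a)
  ... | no _    | yes y≡b = yes (inj₂ y≡b)
  ... | no y≢a  | no y≢b  = no λ { (inj₁ y≡a) → y≢a y≡a ; (inj₂ y≡b) → y≢b y≡b }

  R-hit : ∀ {y} → Hit y → R y
  R-hit (inj₁ refl) = Ra
  R-hit (inj₂ refl) = Rb

  R-transpose : ∀ {x} → R x → R (transpose a b x)
  R-transpose {x} Rx = by-cases (x ≟ a) (x ≟ b)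
    where
    by-cases : Dec (x ≡ a) → Dec (x ≡ b) → R (transpose a b x)
    by-cases (yes refl) _          = subst R (sym (transpose-a a b)) Rb
    by-cases (no _)     (yes refl) = subst R (sym (transpose-b a b)) Ra
    by-cases (no x≢a)   (no x≢b)   = subst R (sym (transpose-other x≢a x≢b)) Rx

  R-transpose⁻ : ∀ {x} → R (transpose a b x) → R x
  R-transpose⁻ {x} Rtx = subst R (transpose-involutive x) (R-transpose Rtx)

  module _ {τ : Vec (Fin m) m} (τ-cycles : UnionOfCycles R τ) where
    open UnionOfCycles τ-cycles

    τ′ : Vec (Fin m) m
    τ′ = τ ∘⟨ a ⇄ b ⟩

    ∘⇄-unionOfCycles : UnionOfCycles R τ′
    ∘⇄-unionOfCycles = record
      { injective = ∘⇄-injective τ a b injective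
      ; preserves = λ Rx → subst R (sym (lookup-∘⇄ τ a b _)) (preserves (R-transpose Rx))
      ; reflects  = λ Rτ′x → R-transpose⁻ (reflects (subst R (lookup-∘⇄ τ a b _) Rτ′x))
      }

    iter-∘⇄ : ∀ d {y} → (∀ {i} → i < d → ¬ Hit (iter τ i y)) → iter τ′ d y ≡ iter τ d y
    iter-∘⇄ zero    _      = refl
    iter-∘⇄ (suc d) {y} no-hit = begin
      lookup τ′ (iter τ′ d y)              ≡⟨ cong (lookup τ′) (iter-∘⇄ d (no-hit ∘ m≤n⇒m≤1+n)) ⟩
      lookup τ′ (iter τ d y)               ≡⟨ lookup-∘⇄ τ a b _ ⟩
      lookup τ (transpose a b (iter τ d y)) ≡⟨ cong (lookup τ) (transpose-other (no-hit ≤-refl ∘ inj₁) (no-hit ≤-refl ∘ inj₂)) ⟩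
      lookup τ (iter τ d y)                ∎
      where open ≡-Reasoning

    a-cycleMin : T (isCycleMin τ a)
    a-cycleMin = cycleMin-intro τ (λ j → a-least (iter-preserves j Ra))

    b-cycleMin⇔ : T (isCycleMin τ b) ⇔ (¬ b ↝⟨ τ ⟩ a)
    b-cycleMin⇔ = mk⇔
      (λ t b↝a → smaller-in-cycle⇒¬cycleMin τ injective b↝a a<b t)
      (λ ¬b↝a → cycleMin-intro τ (λ j → b-least (iter-preserves j Rb) (λ τʲb≡a → ¬b↝a (j , τʲb≡a))))

    -- If the τ-orbit of x met a or b, then x ∈ R, so b < x: impossible for a cycle minimum.
    -- Hence τ′ moves x exactly as τ does.
    other-cycleMin : ∀ {x} → x ≢ a → x ≢ b → T (isCycleMin τ x) → T (isCycleMin τ′ x)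
    other-cycleMin {x} x≢a x≢b t = cycleMin-intro τ′ λ j →
      subst (λ y → toℕ x ≤ toℕ y) (sym (iter-∘⇄ j λ {i} _ → never-hits i)) (cycleMin-elim τ injective {x} t j)
      where
      never-hits : ∀ i → ¬ Hit (iter τ i x)
      never-hits i hit = <⇒≱ (≤-<-trans (hit≤b hit) b<x) (cycleMin-elim τ injective {x} t i)
        where
        Rx : R x
        Rx = iter-reflects i (R-hit hit)
        b<x : toℕ b < toℕ x
        b<x = ≤∧≢⇒< (b-least Rx x≢a) (x≢b ∘ sym ∘ Fin.toℕ-injective)
        hit≤b : ∀ {y} → Hit y → toℕ y ≤ toℕ b
        hit≤b (inj₁ refl) = <⇒≤ a<b
        hit≤b (inj₂ refl) = ≤-refl

    -- follow τ from τ a to the first visit of {a, b}: if it is a, the transposition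
    -- splits the cycle of a and b; if it is b, it merges two cycles
    b↝a-dichotomy : (b ↝⟨ τ ⟩ a × ¬ b ↝⟨ τ′ ⟩ a) ⊎ (¬ b ↝⟨ τ ⟩ a × b ↝⟨ τ′ ⟩ a)
    b↝a-dichotomy with period τ injective a
    ... | p , _ , τᵖ⁺¹a≡a
      with least-witness (λ i → hit? (iter τ i (lookup τ a))) {p} (inj₁ (trans (sym (iter-suc τ p a)) τᵖ⁺¹a≡a))
    ... | d , hit , before = by-hit hit
      where
      τ′b≡τa : lookup τ′ b ≡ lookup τ a
      τ′b≡τa = trans (lookup-∘⇄ τ a b b) (cong (lookup τ) (transpose-b a b))
      run : ∀ {i} → i ≤ d → iter τ′ (suc i) b ≡ iter τ i (lookup τ a)
      run {i} i≤d = begin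
        iter τ′ (suc i) b             ≡⟨ iter-suc τ′ i b ⟩
        iter τ′ i (lookup τ′ b)       ≡⟨ cong (iter τ′ i) τ′b≡τa ⟩
        iter τ′ i (lookup τ a)        ≡⟨ iter-∘⇄ i (λ k<i → before (<-≤-trans k<i i≤d)) ⟩
        iter τ i (lookup τ a)         ∎
        where open ≡-Reasoning
      by-hit : Hit (iter τ d (lookup τ a)) → _
      by-hit (inj₁ τᵈ⁺¹a≡a) = inj₂ (¬b↝a , (suc d , trans (run ≤-refl) τᵈ⁺¹a≡a))
        where
        avoids-b : ∀ {i} → i ≤ d → iter τ i a ≢ b
        avoids-b {zero}  _   = a≢b
        avoids-b {suc i} i<d = before i<d ∘ inj₂ ∘ trans (sym (iter-suc τ i a))
        ¬b↝a : ¬ b ↝⟨ τ ⟩ a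
        ¬b↝a = avoided-within-period τ (trans (iter-suc τ d a) τᵈ⁺¹a≡a) avoids-b ∘ ↝-sym τ injective
      by-hit (inj₂ τᵈ⁺¹a≡b) =
        inj₁ (↝-sym τ injective (suc d , trans (iter-suc τ d a) τᵈ⁺¹a≡b) ,
              avoided-within-period τ′ (trans (run ≤-refl) τᵈ⁺¹a≡b) avoids-a)
        where
        avoids-a : ∀ {i} → i ≤ d → iter τ′ i b ≢ a
        avoids-a {zero}  _   = a≢b ∘ sym
        avoids-a {suc i} i<d = before i<d ∘ inj₁ ∘ trans (sym (run (<⇒≤ i<d)))

  module _ {σ : Vec (Fin m) m} (σ-cycles : UnionOfCycles R σ) where

    private
      σ′ = σ ∘⟨ a ⇄ b ⟩
      σ′-cycles = ∘⇄-unionOfCycles σ-cycles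

    isCycleMin-∘⇄-b : isCycleMin σ′ b ≡ not (isCycleMin σ b)
    isCycleMin-∘⇄-b with b↝a-dichotomy σ-cycles
    ... | inj₁ (b↝a , ¬b↝′a) =
      T-xor⇒≡not (inj₁ (from (b-cycleMin⇔ σ′-cycles) ¬b↝′a , (λ t → to (b-cycleMin⇔ σ-cycles) t b↝a)))
    ... | inj₂ (¬b↝a , b↝′a) =
      T-xor⇒≡not (inj₂ ((λ t → to (b-cycleMin⇔ σ′-cycles) t b↝′a) , from (b-cycleMin⇔ σ-cycles) ¬b↝a))

    isCycleMin-∘⇄-other : ∀ {x} → x ≢ b → isCycleMin σ′ x ≡ isCycleMin σ x
    isCycleMin-∘⇄-other {x} x≢b with x ≟ a
    ... | yes refl = T-injective (λ _ → a-cycleMin σ-cycles) (λ _ → a-cycleMin σ′-cycles)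
    ... | no  x≢a  = T-injective
      (subst (λ τ → T (isCycleMin τ x)) (∘⇄-involutive σ a b) ∘ other-cycleMin σ′-cycles x≢a x≢b)
      (other-cycleMin σ-cycles x≢a x≢b)

    -1^cyc-∘⇄ : -1ℤ ^ cyc σ′ ≡ - (-1ℤ ^ cyc σ)
    -1^cyc-∘⇄ = -1^length-filterᵇ-flip (isCycleMin σ′) (isCycleMin σ) (Unique.allFin⁺ m) (∈-allFin b)
      isCycleMin-∘⇄-other isCycleMin-∘⇄-b

data Path (σ : Vec (Fin m) m) (t : Fin m) : Fin m → List (Fin m) → Set where
  stop : Path σ t t []
  step : ∀ {x cs} → x ≢ t → Path σ t (lookup σ x) cs → Path σ t x (x ∷ cs)

module _ (σ : Vec (Fin m) m) (t : Fin m) where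

  cycleWalk-≢ : ∀ f x {y} → y ∈ cycleWalk σ t f x → y ≢ t
  cycleWalk-≢ (suc f) x y∈ with x ≟ t
  cycleWalk-≢ (suc f) x (here refl) | no x≢t = x≢t
  cycleWalk-≢ (suc f) x (there y∈)  | no _   = cycleWalk-≢ f (lookup σ x) y∈

  cycleWalk⇒Path : ∀ f x → length (cycleWalk σ t f x) < f → Path σ t x (cycleWalk σ t f x)
  cycleWalk⇒Path (suc f) x len< with x ≟ t
  ... | yes refl = stop
  ... | no  x≢t  = step x≢t (cycleWalk⇒Path f (lookup σ x) (≤-pred len<))

  Path⇒cycleWalk : ∀ f {x cs} → Path σ t x cs → length cs < f → cycleWalk σ t f x ≡ cs
  Path⇒cycleWalk (suc f) stop _ with t ≟ t
  ... | yes _   = refl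
  ... | no  t≢t = ⊥-elim (t≢t refl)
  Path⇒cycleWalk (suc f) {x} (step x≢t path) (s≤s len<) with x ≟ t
  ... | yes x≡t = ⊥-elim (x≢t x≡t)
  ... | no  _   = cong (x ∷_) (Path⇒cycleWalk f path len<)

  cycleWalk-cong : ∀ (τ : Vec (Fin m) m) f x → (∀ {y} → y ∈ cycleWalk σ t f x → lookup τ y ≡ lookup σ y) →
    cycleWalk τ t f x ≡ cycleWalk σ t f x
  cycleWalk-cong τ zero    x _   = refl
  cycleWalk-cong τ (suc f) x τ≗σ with x ≟ t
  ... | yes _ = refl
  ... | no  _ = cong (x ∷_) (trans (cong (cycleWalk τ t f) (τ≗σ (here refl)))
                                   (cycleWalk-cong τ f (lookup σ x) (τ≗σ ∘ there)))

  Path-start : ∀ {x cs} → Path σ t x cs → x ∈ t ∷ cs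
  Path-start stop       = here refl
  Path-start (step _ _) = there (here refl)

  private
    ∈-skip : ∀ {x y cs} → y ∈ t ∷ cs → y ∈ t ∷ x ∷ cs
    ∈-skip (here refl) = here refl
    ∈-skip (there y∈)  = there (there y∈)

  Path-next : ∀ {x cs} → Path σ t x cs → ∀ {y} → y ∈ cs → lookup σ y ∈ t ∷ cs
  Path-next (step _ path) (here refl) = ∈-skip (Path-start path)
  Path-next (step _ path) (there y∈)  = ∈-skip (Path-next path y∈)

  Path-reaches : ∀ {x cs} → Path σ t x cs → ∀ {y} → y ∈ t ∷ cs → x ↝⟨ σ ⟩ y
  Path-reaches stop          (here refl)         = 0 , refl
  Path-reaches (step _ _)    (there (here refl)) = 0 , refl
  Path-reaches (step _ path) (here refl)         = ↝-step σ (Path-reaches path (here refl))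
  Path-reaches (step _ path) (there (there y∈))  = ↝-step σ (Path-reaches path (there y∈))

  Path-cong : ∀ (τ : Vec (Fin m) m) {x cs} → Path σ t x cs → (∀ {y} → y ∈ cs → lookup τ y ≡ lookup σ y) →
    Path τ t x cs
  Path-cong τ stop                _   = stop
  Path-cong τ (step x≢t path) τ≗σ =
    step x≢t (subst (λ z → Path τ t z _) (sym (τ≗σ (here refl))) (Path-cong τ path (τ≗σ ∘ there)))

Path-start-≡ : ∀ {σ τ : Vec (Fin m) m} {t x y cs} → Path σ t x cs → Path τ t y cs → x ≡ y
Path-start-≡ stop       stop       = refl
Path-start-≡ (step _ _) (step _ _) = refl

Path-agree : ∀ {σ τ : Vec (Fin m) m} {t x cs} → Path σ t x cs → Path τ t x cs →
  ∀ {y} → y ∈ cs → lookup σ y ≡ lookup τ y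
Path-agree (step _ σ-path) (step _ τ-path) (here refl) = Path-start-≡ σ-path τ-path
Path-agree (step _ σ-path) (step _ τ-path) (there y∈)  =
  Path-agree σ-path (subst (λ z → Path _ _ z _) (sym (Path-start-≡ σ-path τ-path)) τ-path) y∈

cycleThrough : Fin m → List (Fin m) → Vec (Fin m) m
cycleThrough t []       = tabulate id
cycleThrough t (c ∷ cs) = cycleThrough t cs ∘⟨ t ⇄ c ⟩

module _ (t : Fin m) where

  cycleThrough-fixes : ∀ cs {x} → x ∉ t ∷ cs → lookup (cycleThrough t cs) x ≡ x
  cycleThrough-fixes []       {x} _    = lookup∘tabulate id x
  cycleThrough-fixes (c ∷ cs) {x} x∉ = begin
    lookup (cycleThrough t cs ∘⟨ t ⇄ c ⟩) x
      ≡⟨ lookup-∘⇄ (cycleThrough t cs) t c x ⟩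
    lookup (cycleThrough t cs) (transpose t c x)
      ≡⟨ cong (lookup (cycleThrough t cs)) (transpose-other (x∉ ∘ here) (x∉ ∘ there ∘ here)) ⟩
    lookup (cycleThrough t cs) x
      ≡⟨ cycleThrough-fixes cs (λ { (here x≡t) → x∉ (here x≡t) ; (there x∈) → x∉ (there (there x∈)) }) ⟩
    x ∎
    where open ≡-Reasoning

  cycleThrough-injective : ∀ cs → InjectiveTable (cycleThrough t cs)
  cycleThrough-injective []       {x} {y} eq = trans (sym (lookup∘tabulate id x)) (trans eq (lookup∘tabulate id y))
  cycleThrough-injective (c ∷ cs) = ∘⇄-injective (cycleThrough t cs) t c (cycleThrough-injective cs)

  -- composing with the transposition (t c) inserts c into the cycle of t, right after t
  cycleThrough-Path : ∀ {cs} → Unique cs → t ∉ cs → Path (cycleThrough t cs) t (lookup (cycleThrough t cs) t) cs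
  cycleThrough-Path {[]}     _              _   = subst (λ x → Path _ t x []) (sym (lookup∘tabulate id t)) stop
  cycleThrough-Path {c ∷ cs} (c≢cs ∷ cs!) t∉ =
    subst (λ x → Path σ′ t x (c ∷ cs)) (sym σ′t≡c)
      (step (t∉ ∘ here ∘ sym) (subst (λ x → Path σ′ t x cs) (sym σ′c≡σt) path′))
    where
    σ = cycleThrough t cs
    σ′ = σ ∘⟨ t ⇄ c ⟩
    c∉cs : c ∉ cs
    c∉cs c∈ = All.lookup c≢cs c∈ refl
    σ′t≡c : lookup σ′ t ≡ c
    σ′t≡c = trans (lookup-∘⇄ σ t c t) (trans (cong (lookup σ) (transpose-a t c))
              (cycleThrough-fixes cs λ { (here c≡t) → t∉ (here (sym c≡t)) ; (there c∈) → c∉cs c∈ }))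
    σ′c≡σt : lookup σ′ c ≡ lookup σ t
    σ′c≡σt = trans (lookup-∘⇄ σ t c c) (cong (lookup σ) (transpose-b t c))
    path′ : Path σ′ t (lookup σ t) cs
    path′ = Path-cong σ t σ′ (cycleThrough-Path cs! (t∉ ∘ there)) λ {y} y∈ →
      trans (lookup-∘⇄ σ t c y) (cong (lookup σ)
        (transpose-other (λ y≡t → t∉ (there (subst (_∈ cs) y≡t y∈))) (λ y≡c → c∉cs (subst (_∈ cs) y≡c y∈))))

-- The cycle of the top point

Perm : ℕ → Set
Perm n = Vec (Fin (suc n)) (suc n)

module _ {n : ℕ} where

  open DecMembership (_≟_ {suc n}) using (_∈?_)

  top : Fin (suc n)
  top = fromℕ n

  walk : Perm n → List (Fin (suc n))
  walk σ = cycleWalk σ top (suc n) (lookup σ top)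

  topCycle : Perm n → List (Fin (suc n))
  topCycle σ = top ∷ walk σ

  complement : List (Fin (suc n)) → List (Fin (suc n))
  complement xs = filter (λ x → ¬? (x ∈? xs)) (allFin (suc n))

  ∈-complement⁻ : ∀ xs {x} → x ∈ complement xs → x ∉ xs
  ∈-complement⁻ xs = proj₂ ∘ ∈-filter⁻ (λ x → ¬? (x ∈? xs)) {xs = allFin (suc n)}

  ∈-complement⁺ : ∀ xs {x} → x ∉ xs → x ∈ complement xs
  ∈-complement⁺ xs = ∈-filter⁺ (λ x → ¬? (x ∈? xs)) (∈-allFin _)

  complement-ascending : ∀ xs → AllPairs Fin._<_ (complement xs)
  complement-ascending xs = AllPairs.filter⁺ (λ x → ¬? (x ∈? xs)) (AllPairs.tabulate⁺-< id)

  ∉-complement-∷ : ∀ {x} xs → x ∉ complement (x ∷ xs)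
  ∉-complement-∷ xs x∈ = ∈-complement⁻ (_ ∷ xs) x∈ (here refl)

  offCycle : Perm n → List (Fin (suc n))
  offCycle σ = complement (topCycle σ)

  ≢top⇒∈inject₁ : ∀ {x} → x ≢ top → x ∈ map inject₁ (allFin n)
  ≢top⇒∈inject₁ {x} x≢top =
    subst (_∈ map inject₁ (allFin n)) (Fin.inject₁-lower₁ x n≢x) (∈-map⁺ inject₁ (∈-allFin _))
    where
    n≢x : n ≢ toℕ x
    n≢x n≡x = x≢top (Fin.toℕ-injective (trans (sym n≡x) (sym (Fin.toℕ-fromℕ n))))

  length-avoiding-top : ∀ {xs} → Unique xs → top ∉ xs → length xs < suc n
  length-avoiding-top {xs} xs! top∉xs = s≤s (subst (length xs ≤_) length-inject₁s
    (length-≤-⊆ _≟_ xs! (Unique.map⁺ Fin.inject₁-injective (Unique.allFin⁺ n))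
      (λ x∈xs → ≢top⇒∈inject₁ (λ { refl → top∉xs x∈xs }))))
    where
    length-inject₁s : length (map inject₁ (allFin n)) ≡ n
    length-inject₁s = trans (length-map inject₁ (allFin n)) (List.length-tabulate id)

  Path-start-least : ∀ {σ : Perm n} {x cs} → Path σ top x cs → AllPairs Fin._<_ cs →
    ∀ {y} → y ∈ top ∷ cs → toℕ x ≤ toℕ y
  Path-start-least stop       _          (here refl)         = ≤-refl
  Path-start-least (step _ _) _          (here refl)         = Fin.≤fromℕ _
  Path-start-least (step _ _) _          (there (here refl)) = ≤-refl
  Path-start-least (step _ _) (x<cs ∷ _) (there (there y∈))  = <⇒≤ (All.lookup x<cs y∈)

  module TopCycle {σ : Perm n} (σ∈Qhat : σ ∈ Qhat n) where

    σ-injective : InjectiveTable σ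
    σ-injective {x} {y} = proj₁ (to ∈-Qhat σ∈Qhat) {x} {y}

    walk-ascending : AllPairs Fin._<_ (walk σ)
    walk-ascending = Linked.Linked⇒AllPairs Fin.<-trans
      (strictlyIncreasing⇒Linked (walk σ) (proj₂ (to ∈-Qhat σ∈Qhat)))

    top∉walk : top ∉ walk σ
    top∉walk top∈ = cycleWalk-≢ σ top (suc n) (lookup σ top) top∈ refl

    path : Path σ top (lookup σ top) (walk σ)
    path = cycleWalk⇒Path σ top (suc n) (lookup σ top)
      (length-avoiding-top (ascending⇒unique walk-ascending) top∉walk)

    topCycle-closed : ∀ {x} → x ∈ topCycle σ → lookup σ x ∈ topCycle σ
    topCycle-closed (here refl) = Path-start σ top path
    topCycle-closed (there x∈)  = Path-next σ top path x∈

    iter-topCycle : ∀ j {x} → x ∈ topCycle σ → iter σ j x ∈ topCycle σ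
    iter-topCycle zero    x∈ = x∈
    iter-topCycle (suc j) x∈ = topCycle-closed (iter-topCycle j x∈)

    ∈topCycle⇔ : ∀ {x} → x ∈ topCycle σ ⇔ top ↝⟨ σ ⟩ x
    ∈topCycle⇔ = mk⇔ (↝-step σ ∘ Path-reaches σ top path) λ { (j , refl) → iter-topCycle j (here refl) }

    topCycle-preimage : ∀ {x} → lookup σ x ∈ topCycle σ → x ∈ topCycle σ
    topCycle-preimage σx∈ = from ∈topCycle⇔ (↝-sym σ σ-injective
      (↝-step σ (↝-sym σ σ-injective (to ∈topCycle⇔ σx∈))))

    offCycle-unionOfCycles : UnionOfCycles (_∉ topCycle σ) σ
    offCycle-unionOfCycles = record
      { injective = σ-injective
      ; preserves = λ x∉ σx∈ → x∉ (topCycle-preimage σx∈)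
      ; reflects  = λ σx∉ x∈ → σx∉ (topCycle-closed x∈)
      }

    σtop∈topCycle : lookup σ top ∈ topCycle σ
    σtop∈topCycle = topCycle-closed (here refl)

    σtop-least : ∀ {y} → y ∈ topCycle σ → toℕ (lookup σ top) ≤ toℕ y
    σtop-least = Path-start-least path walk-ascending

    -- σ top is the least point of the cycle of top, hence its only cycle minimum
    cyc-unicyclic : (∀ {x} → x ∈ offCycle σ → lookup σ x ≡ x) → cyc σ ≡ suc (length (offCycle σ))
    cyc-unicyclic fixes = ↭.↭-length (unique-⊆-⊇⇒↭
      (Unique.filter⁺ (T? ∘ isCycleMin σ) (Unique.allFin⁺ (suc n))) minima!
      (only-minima ∘ proj₂ ∘ ∈-filter⁻ (T? ∘ isCycleMin σ) {xs = allFin (suc n)})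
      (∈-filter⁺ (T? ∘ isCycleMin σ) (∈-allFin _) ∘ minima))
      where
      minima! : Unique (lookup σ top ∷ offCycle σ)
      minima! = All.tabulate (λ y∈ σtop≡y → ∈-complement⁻ (topCycle σ) y∈ (subst (_∈ topCycle σ) σtop≡y σtop∈topCycle))
              ∷ ascending⇒unique (complement-ascending (topCycle σ))
      only-minima : ∀ {x} → T (isCycleMin σ x) → x ∈ lookup σ top ∷ offCycle σ
      only-minima {x} t with x ∈? topCycle σ
      ... | no  x∉ = there (∈-complement⁺ (topCycle σ) x∉)
      ... | yes x∈ with x ≟ lookup σ top
      ...   | yes x≡σtop = here x≡σtop
      ...   | no  x≢σtop = ⊥-elim (smaller-in-cycle⇒¬cycleMin σ σ-injective
              (↝-sym σ σ-injective (Path-reaches σ top path x∈))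
              (≤∧≢⇒< (σtop-least x∈) (x≢σtop ∘ sym ∘ Fin.toℕ-injective)) t)
      iter-fixed : ∀ {x} → x ∈ offCycle σ → ∀ j → iter σ j x ≡ x
      iter-fixed x∈ zero    = refl
      iter-fixed x∈ (suc j) = trans (cong (lookup σ) (iter-fixed x∈ j)) (fixes x∈)
      minima : ∀ {x} → x ∈ lookup σ top ∷ offCycle σ → T (isCycleMin σ x)
      minima (here refl) = cycleMin-intro σ (λ j → σtop-least (iter-topCycle j σtop∈topCycle))
      minima (there x∈)  = cycleMin-intro σ (λ j → ≤-reflexive (cong toℕ (sym (iter-fixed x∈ j))))

-- The sign-reversing involution

module _ {n : ℕ} where

  _∘⇄-firstTwo_ : Perm n → List (Fin (suc n)) → Perm n
  σ ∘⇄-firstTwo (a ∷ b ∷ _) = σ ∘⟨ a ⇄ b ⟩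
  σ ∘⇄-firstTwo _           = σ

  ι : Perm n → Perm n
  ι σ = σ ∘⇄-firstTwo offCycle σ

  module _ {σ : Perm n} {a b : Fin (suc n)} (a∉ : a ∉ topCycle σ) (b∉ : b ∉ topCycle σ) where

    walk-∘⇄ : walk (σ ∘⟨ a ⇄ b ⟩) ≡ walk σ
    walk-∘⇄ = trans (cong (cycleWalk σ′ top (suc n)) (agrees (here refl)))
                    (cycleWalk-cong σ top σ′ (suc n) (lookup σ top) (agrees ∘ there))
      where
      σ′ = σ ∘⟨ a ⇄ b ⟩
      agrees : ∀ {y} → y ∈ topCycle σ → lookup σ′ y ≡ lookup σ y
      agrees {y} y∈ = trans (lookup-∘⇄ σ a b y)
        (cong (lookup σ) (transpose-other (λ { refl → a∉ y∈ }) (λ { refl → b∉ y∈ })))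

    offCycle-∘⇄ : offCycle (σ ∘⟨ a ⇄ b ⟩) ≡ offCycle σ
    offCycle-∘⇄ = cong (λ w → complement (top ∷ w)) walk-∘⇄

  private
    ∉topCycle : ∀ {σ : Perm n} {x xs} → offCycle σ ≡ xs → x ∈ xs → x ∉ topCycle σ
    ∉topCycle {σ} eq x∈ = ∈-complement⁻ (topCycle σ) (subst (_ ∈_) (sym eq) x∈)

  ι-involutive : ∀ σ → ι (ι σ) ≡ σ
  ι-involutive σ with offCycle σ in eq
  ... | []        rewrite eq = refl
  ... | _ ∷ []    rewrite eq = refl
  ... | a ∷ b ∷ _ rewrite offCycle-∘⇄ (∉topCycle eq (here refl)) (∉topCycle eq (there (here refl))) | eq =
    ∘⇄-involutive σ a b

  ι-preserves-injectivity : ∀ {σ} → InjectiveTable σ → InjectiveTable (ι σ)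
  ι-preserves-injectivity {σ} σ-injective with offCycle σ
  ... | []        = σ-injective
  ... | _ ∷ []    = σ-injective
  ... | a ∷ b ∷ _ = ∘⇄-injective σ a b σ-injective

  ι-preserves-increasing : ∀ {σ} → T (inQhat σ) → T (inQhat (ι σ))
  ι-preserves-increasing {σ} σ-increasing with offCycle σ in eq
  ... | []        = σ-increasing
  ... | _ ∷ []    = σ-increasing
  ... | a ∷ b ∷ _ = subst (T ∘ strictlyIncreasing)
    (sym (walk-∘⇄ (∉topCycle eq (here refl)) (∉topCycle eq (there (here refl))))) σ-increasing

  ι-∈Qhat : ∀ {σ} → σ ∈ Qhat n → ι σ ∈ Qhat n
  ι-∈Qhat σ∈Qhat = from ∈-Qhat
    (ι-preserves-injectivity (TopCycle.σ-injective σ∈Qhat) , ι-preserves-increasing (proj₂ (to ∈-Qhat σ∈Qhat)))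

  module _ {σ : Perm n} (σ∈Qhat : σ ∈ Qhat n) where
    open TopCycle σ∈Qhat

    private
      offCycle-first-two : ∀ {a b r} → offCycle σ ≡ a ∷ b ∷ r →
        a Fin.< b × (∀ {y} → y ∉ topCycle σ → y ≢ a → b Fin.≤ y)
      offCycle-first-two eq = ascending-first< ascending ,
        λ y∉ → ascending-second-least ascending (subst (_ ∈_) eq (∈-complement⁺ (topCycle σ) y∉))
        where ascending = subst (AllPairs Fin._<_) eq (complement-ascending (topCycle σ))

    -1^cyc-ι : ι σ ≢ σ → -1ℤ ^ cyc (ι σ) ≡ - (-1ℤ ^ cyc σ)
    -1^cyc-ι ισ≢σ with offCycle σ in eq
    ... | []        = ⊥-elim (ισ≢σ refl)
    ... | _ ∷ []    = ⊥-elim (ισ≢σ refl)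
    ... | a ∷ b ∷ _ = SwapLeastPair.-1^cyc-∘⇄ (∉topCycle eq (here refl)) (∉topCycle eq (there (here refl)))
      (proj₁ (offCycle-first-two eq)) (proj₂ (offCycle-first-two eq)) offCycle-unionOfCycles

    ι-fixed⇒offCycle-small : ι σ ≡ σ → offCycle σ ≡ [] ⊎ ∃[ c ] offCycle σ ≡ c ∷ []
    ι-fixed⇒offCycle-small ισ≡σ with offCycle σ in eq
    ... | []        = inj₁ refl
    ... | c ∷ []    = inj₂ (c , refl)
    ... | a ∷ b ∷ _ = ⊥-elim (<-irrefl (cong toℕ a≡b) (proj₁ (offCycle-first-two eq)))
      where
      a≡b : a ≡ b
      a≡b = σ-injective (begin
        lookup σ a                 ≡⟨ cong (λ τ → lookup τ a) ισ≡σ ⟨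
        lookup (σ ∘⟨ a ⇄ b ⟩) a    ≡⟨ lookup-∘⇄ σ a b a ⟩
        lookup σ (transpose a b a) ≡⟨ cong (lookup σ) (transpose-a a b) ⟩
        lookup σ b                 ∎)
        where open ≡-Reasoning

-- Its fixed points

module _ {n : ℕ} where

  open DecMembership (_≟_ {suc n}) using (_∈?_)

  cycleAvoiding : List (Fin (suc n)) → Perm n
  cycleAvoiding S = cycleThrough top (complement (top ∷ S))

  module CycleAvoiding {S : List (Fin (suc n))} (top∉S : top ∉ S) (S-ascending : AllPairs Fin._<_ S) where

    private
      σ  = cycleAvoiding S
      cs = complement (top ∷ S)

    walk-cycleAvoiding : walk σ ≡ cs
    walk-cycleAvoiding = Path⇒cycleWalk σ top (suc n) (cycleThrough-Path top cs! (∉-complement-∷ S))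
      (length-avoiding-top cs! (∉-complement-∷ S))
      where cs! = ascending⇒unique (complement-ascending (top ∷ S))

    cycleAvoiding∈Qhat : σ ∈ Qhat n
    cycleAvoiding∈Qhat = from ∈-Qhat
      ( cycleThrough-injective top cs
      , subst (T ∘ strictlyIncreasing) (sym walk-cycleAvoiding)
          (Linked⇒strictlyIncreasing (Linked.AllPairs⇒Linked (complement-ascending (top ∷ S)))))

    offCycle-cycleAvoiding : offCycle σ ≡ S
    offCycle-cycleAvoiding rewrite walk-cycleAvoiding =
      ascending-≡ (complement-ascending (top ∷ cs)) S-ascending
        (λ {x} x∈ → outside-cycle (∈-complement⁻ (top ∷ cs) x∈))
        (λ x∈S → ∈-complement⁺ (top ∷ cs)
          λ { (here refl) → top∉S x∈S ; (there x∈cs) → ∈-complement⁻ (top ∷ S) x∈cs (there x∈S) })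
      where
      outside-cycle : ∀ {x} → x ∉ top ∷ cs → x ∈ S
      outside-cycle {x} x∉ with x ∈? top ∷ S
      ... | yes (here x≡top) = ⊥-elim (x∉ (here x≡top))
      ... | yes (there x∈S)  = x∈S
      ... | no  x∉top∷S      = ⊥-elim (x∉ (there (∈-complement⁺ (top ∷ S) x∉top∷S)))

    -1^cyc-cycleAvoiding : -1ℤ ^ cyc σ ≡ -1ℤ ^ suc (length S)
    -1^cyc-cycleAvoiding = cong (-1ℤ ^_) (trans
      (TopCycle.cyc-unicyclic cycleAvoiding∈Qhat fixes)
      (cong (suc ∘ length) offCycle-cycleAvoiding))
      where
      fixes : ∀ {x} → x ∈ offCycle σ → lookup σ x ≡ x
      fixes x∈ = cycleThrough-fixes top cs
        (∈-complement⁻ (top ∷ cs) (subst (_ ∈_) (cong (λ w → complement (top ∷ w)) walk-cycleAvoiding) x∈))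

  module _ {σ : Perm n} (σ∈Qhat : σ ∈ Qhat n) (fixes : ∀ {x} → x ∈ offCycle σ → lookup σ x ≡ x) where
    open TopCycle σ∈Qhat

    private
      τ = cycleAvoiding (offCycle σ)

      walk≡complement : walk σ ≡ complement (top ∷ offCycle σ)
      walk≡complement = ascending-≡ walk-ascending (complement-ascending (top ∷ offCycle σ)) walk⊆ walk⊇
        where
        walk⊆ : ∀ {x} → x ∈ walk σ → x ∈ complement (top ∷ offCycle σ)
        walk⊆ x∈ = ∈-complement⁺ (top ∷ offCycle σ)
          λ { (here refl) → top∉walk x∈ ; (there x∈off) → ∈-complement⁻ (topCycle σ) x∈off (there x∈) }
        walk⊇ : ∀ {x} → x ∈ complement (top ∷ offCycle σ) → x ∈ walk σ
        walk⊇ {x} x∈ with x ∈? topCycle σ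
        ... | yes (here x≡top) = ⊥-elim (∈-complement⁻ (top ∷ offCycle σ) x∈ (here x≡top))
        ... | yes (there x∈w)  = x∈w
        ... | no  x∉           = ⊥-elim (∈-complement⁻ (top ∷ offCycle σ) x∈ (there (∈-complement⁺ (topCycle σ) x∉)))

      τ-path : Path τ top (lookup τ top) (walk σ)
      τ-path = subst (Path τ top (lookup τ top)) (sym walk≡complement)
        (cycleThrough-Path top (ascending⇒unique (complement-ascending (top ∷ offCycle σ))) (∉-complement-∷ (offCycle σ)))

      σtop≡τtop : lookup σ top ≡ lookup τ top
      σtop≡τtop = Path-start-≡ path τ-path

    unicyclic≡cycleAvoiding : σ ≡ cycleAvoiding (offCycle σ)
    unicyclic≡cycleAvoiding = trans (sym (tabulate∘lookup σ)) (trans (tabulate-cong agree) (tabulate∘lookup τ))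
      where
      agree : ∀ x → lookup σ x ≡ lookup τ x
      agree x with x ∈? topCycle σ
      ... | yes (here refl) = σtop≡τtop
      ... | yes (there x∈)  = Path-agree path (subst (λ z → Path τ top z (walk σ)) (sym σtop≡τtop) τ-path) x∈
      ... | no  x∉          = trans (fixes x∈off) (sym (cycleThrough-fixes top (complement (top ∷ offCycle σ))
        λ { (here x≡top) → x∉ (here x≡top) ; (there x∈cs) → ∈-complement⁻ (top ∷ offCycle σ) x∈cs (there x∈off) }))
        where x∈off = ∈-complement⁺ (topCycle σ) x∉

  -- zero stands for no point off the cycle of top, suc k for the single point inject₁ k
  isolated : Fin (suc n) → List (Fin (suc n))
  isolated Fin.zero    = []
  isolated (Fin.suc k) = inject₁ k ∷ []

  singleCycle : Fin (suc n) → Perm n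
  singleCycle i = cycleAvoiding (isolated i)

  private
    top∉isolated : ∀ i → top ∉ isolated i
    top∉isolated (Fin.suc k) (here top≡k) = Fin.fromℕ≢inject₁ top≡k

    isolated-ascending : ∀ i → AllPairs Fin._<_ (isolated i)
    isolated-ascending Fin.zero    = []
    isolated-ascending (Fin.suc k) = [] ∷ []

    module Single (i : Fin (suc n)) = CycleAvoiding (top∉isolated i) (isolated-ascending i)

  singleCycle-injective : ∀ {i j} → singleCycle i ≡ singleCycle j → i ≡ j
  singleCycle-injective {i} {j} eq = isolated-injective (trans (sym (Single.offCycle-cycleAvoiding i))
    (trans (cong offCycle eq) (Single.offCycle-cycleAvoiding j)))
    where
    isolated-injective : ∀ {i j} → isolated i ≡ isolated j → i ≡ j
    isolated-injective {Fin.zero}  {Fin.zero}  _  = refl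
    isolated-injective {Fin.suc _} {Fin.suc _} eq = cong Fin.suc (Fin.inject₁-injective (List.∷-injectiveˡ eq))

  ι-singleCycle : ∀ i → ι (singleCycle i) ≡ singleCycle i
  ι-singleCycle i rewrite Single.offCycle-cycleAvoiding i with i
  ... | Fin.zero  = refl
  ... | Fin.suc _ = refl

  module _ {σ : Perm n} (σ∈Qhat : σ ∈ Qhat n) (ισ≡σ : ι σ ≡ σ) where
    open TopCycle σ∈Qhat

    private
      small : offCycle σ ≡ [] ⊎ ∃[ c ] offCycle σ ≡ c ∷ []
      small = ι-fixed⇒offCycle-small σ∈Qhat ισ≡σ

    ι-fixed⇒offCycle≡isolated : ∃[ i ] offCycle σ ≡ isolated i
    ι-fixed⇒offCycle≡isolated = by-size small
      where
      by-size : offCycle σ ≡ [] ⊎ ∃[ c ] offCycle σ ≡ c ∷ [] → ∃[ i ] offCycle σ ≡ isolated i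
      by-size (inj₁ eq)       = Fin.zero , eq
      by-size (inj₂ (c , eq)) = Fin.suc (lower₁ c n≢c) , trans eq (cong (_∷ []) (sym (Fin.inject₁-lower₁ c n≢c)))
        where
        n≢c : n ≢ toℕ c
        n≢c n≡c = ∈-complement⁻ (topCycle σ) (subst (c ∈_) (sym eq) (here refl))
          (here (Fin.toℕ-injective (trans (sym n≡c) (sym (Fin.toℕ-fromℕ n)))))

    ι-fixed⇒fixes-offCycle : ∀ {x} → x ∈ offCycle σ → lookup σ x ≡ x
    ι-fixed⇒fixes-offCycle {x} x∈ = by-size small
      where
      σx∈ : lookup σ x ∈ offCycle σ
      σx∈ = ∈-complement⁺ (topCycle σ) (∈-complement⁻ (topCycle σ) x∈ ∘ topCycle-preimage)
      by-size : offCycle σ ≡ [] ⊎ ∃[ c ] offCycle σ ≡ c ∷ [] → lookup σ x ≡ x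
      by-size (inj₁ eq)       = ⊥-elim (∉[] (subst (x ∈_) eq x∈))
        where ∉[] : x ∉ [] ; ∉[] ()
      by-size (inj₂ (c , eq)) = singleton (subst (x ∈_) eq x∈) (subst (lookup σ x ∈_) eq σx∈)
        where
        singleton : x ∈ c ∷ [] → lookup σ x ∈ c ∷ [] → lookup σ x ≡ x
        singleton (here x≡c) (here σx≡c) = trans σx≡c (sym x≡c)

  _≟ₚ_ : DecidableEquality (Perm n)
  _≟ₚ_ = Vec.≡-dec _≟_

  fixedPoints : List (Perm n)
  fixedPoints = filter (λ σ → ι σ ≟ₚ σ) (Qhat n)

  fixedPoints↭singleCycles : fixedPoints ↭ map singleCycle (allFin (suc n))
  fixedPoints↭singleCycles = unique-⊆-⊇⇒↭
    (Unique.filter⁺ (λ σ → ι σ ≟ₚ σ) (Qhat! n)) (Unique.map⁺ singleCycle-injective (Unique.allFin⁺ (suc n)))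
    fixed⇒single single⇒fixed
    where
    fixed⇒single : ∀ {σ} → σ ∈ fixedPoints → σ ∈ map singleCycle (allFin (suc n))
    fixed⇒single σ∈ with ∈-filter⁻ (λ σ → ι σ ≟ₚ σ) {xs = Qhat n} σ∈
    ... | σ∈Qhat , ισ≡σ with ι-fixed⇒offCycle≡isolated σ∈Qhat ισ≡σ
    ... | i , offCycle≡ = subst (_∈ map singleCycle (allFin (suc n)))
      (sym (trans (unicyclic≡cycleAvoiding σ∈Qhat (ι-fixed⇒fixes-offCycle σ∈Qhat ισ≡σ)) (cong cycleAvoiding offCycle≡)))
      (∈-map⁺ singleCycle (∈-allFin i))
    single⇒fixed : ∀ {σ} → σ ∈ map singleCycle (allFin (suc n)) → σ ∈ fixedPoints
    single⇒fixed σ∈ with ∈-map⁻ singleCycle σ∈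
    ... | i , _ , refl = ∈-filter⁺ (λ σ → ι σ ≟ₚ σ) (Single.cycleAvoiding∈Qhat i) (ι-singleCycle i)

  -1^cyc-singleCycle : ∀ i → -1ℤ ^ cyc (singleCycle i) ≡ -1ℤ ^ suc (length (isolated i))
  -1^cyc-singleCycle i = Single.-1^cyc-cycleAvoiding i

sumℤ-singleCycles : ∀ n → sumℤ (map (λ σ → -1ℤ ^ cyc σ) (map singleCycle (allFin (suc n)))) ≡ + n - + 1
sumℤ-singleCycles n = begin
  sumℤ (map w (map singleCycle (allFin (suc n))))
    ≡⟨ cong sumℤ (map-∘ {g = w} {f = singleCycle} (allFin (suc n))) ⟨
  w (singleCycle Fin.zero) + sumℤ (map (w ∘ singleCycle) (List.tabulate Fin.suc))
    ≡⟨ cong₂ _+_ (-1^cyc-singleCycle {n} Fin.zero) (cong sumℤ (trans (map-tabulate Fin.suc (w ∘ singleCycle))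
         (List.tabulate-cong (-1^cyc-singleCycle {n} ∘ Fin.suc)))) ⟩
  -1ℤ + sumℤ (List.tabulate {n = n} (λ _ → + 1))
    ≡⟨ cong (_+_ -1ℤ) (sumℤ-ones n) ⟩
  -1ℤ + + n
    ≡⟨ ℤ.+-comm -1ℤ (+ n) ⟩
  + n - + 1 ∎
  where
  open ≡-Reasoning
  w : Perm n → ℤ
  w σ = -1ℤ ^ cyc σ

proposition3p6 : (n : ℕ) → 2 ≤ n →
    sumℤ (map (λ σ → -1ℤ ^ cyc σ) (Qhat n)) ≡ + n - + 1
proposition3p6 n _ = begin
  sumℤ (map w (Qhat n))                           ≡⟨ sumℤ-over-fixedPoints _≟ₚ_ w ι ι-involutive (Qhat! n) ι-∈Qhat -1^cyc-ι ⟩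
  sumℤ (map w fixedPoints)                        ≡⟨ sumℤ-↭ (↭.map⁺ w fixedPoints↭singleCycles) ⟩
  sumℤ (map w (map singleCycle (allFin (suc n)))) ≡⟨ sumℤ-singleCycles n ⟩
  + n - + 1                                       ∎
  where
  open ≡-Reasoning
  w : Perm n → ℤ
  w σ = -1ℤ ^ cyc σ
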